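{- Let $\alpha$, $\beta$, $\gamma$ be arbitrary $0$-$1$ strings. Then, as \textsc{flipping coins} positions, $\alpha1\beta0\gamma>\alpha0\beta1\gamma$. Moreover, for every integer $r\ge0$, $\beta10^r1>\beta$.
   Context: \textsc{Flipping coins}: a position is a finite string $d_1d_2\ldots d_n$ with each $d_i\in\{0,1\}$ (written left to right). Any $0$s after the last $1$ are deleted, so a position is either empty or ends in $1$; a string with trailing $0$s denotes the position obtained by deleting them. - A Left move chooses indices $i<j$ with $d_i=d_j=1$ and changes both to $0$. - A Right move chooses indices $k<\ell$ with $d_k=0$ and $d_\ell=1$, and changes $d_k$ to $1$ and $d_\ell$ to $0$. - After any move, trailing $0$s are deleted. The game is played under normal play, and positions are compared as short partizan games. Juxtaposition denotes concatenation, and $0^r$ denotes $r$ consecutive $0$s. -}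

module Defs where

open import Data.Bool using (Bool; true; false; if_then_else_)
open import Data.Nat using (ℕ; zero; suc; _+_)
open import Data.Fin using (Fin)
open import Data.List using (List; []; _∷_; map; _++_; length; lookup)
open import Data.Product using (_×_)
open import Relation.Nullary using (¬_)

data Game : Set where
  mk : (m n : ℕ) → (Fin m → Game) → (Fin n → Game) → Game

_≤G_ : Game → Game → Set
mk m n gl gr ≤G mk m' n' hl hr =
  ((i : Fin m) → ¬ (mk m' n' hl hr ≤G gl i)) ×
  ((j : Fin n') → ¬ (hr j ≤G mk m n gl gr))

_>G_ : Game → Game → Set
G >G H = (H ≤G G) × ¬ (G ≤G H)

-- Flipping coins.  A string is a List Bool (true = 1, false = 0),
-- read left to right.

strip : List Bool → List Bool
strip [] = []
strip (b ∷ xs) with strip xs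
... | [] = if b then true ∷ [] else []
... | y ∷ ys = b ∷ y ∷ ys

clearOne : List Bool → List (List Bool)
clearOne [] = []
clearOne (true ∷ xs) = (false ∷ xs) ∷ map (true ∷_) (clearOne xs)
clearOne (false ∷ xs) = map (false ∷_) (clearOne xs)

-- Left: choose i < j with d_i = d_j = 1, change both to 0
leftMoves : List Bool → List (List Bool)
leftMoves [] = []
leftMoves (true ∷ xs) = map (false ∷_) (clearOne xs) ++ map (true ∷_) (leftMoves xs)
leftMoves (false ∷ xs) = map (false ∷_) (leftMoves xs)

-- Right: choose k < ℓ with d_k = 0, d_ℓ = 1, change d_k to 1 and d_ℓ to 0
rightMoves : List Bool → List (List Bool)
rightMoves [] = []
rightMoves (true ∷ xs) = map (true ∷_) (rightMoves xs)
rightMoves (false ∷ xs) = map (true ∷_) (clearOne xs) ++ map (false ∷_) (rightMoves xs)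

ones : List Bool → ℕ
ones [] = 0
ones (b ∷ xs) = (if b then 1 else 0) + ones xs

-- weight = Σ over 1s at (1-based) position p of p.  Every move strictly
-- decreases it (a Left move by ≥ 3, a Right move by ℓ - k ≥ 1), so it
-- bounds the length of any play; used as fuel below.
weight : List Bool → ℕ
weight [] = 0
weight (b ∷ xs) = ones (b ∷ xs) + weight xs

build : ℕ → List Bool → Game
build zero _ = mk 0 0 (λ ()) (λ ())
build (suc f) p =
  mk (length L) (length R) (λ i → build f (lookup L i)) (λ j → build f (lookup R j))
  where
    L = map strip (leftMoves p)
    R = map strip (rightMoves p)

coins : List Bool → Game
coins s = build (weight (strip s)) (strip s)

-- Moving one coin to the left (a Right move) can only help Left.  If G arises from H
-- by such a shift, every Left move from H is answered by a Left move from G (the same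
-- one, or one after which the two positions are again a shift apart), and every Right
-- move from G by a Right move from H in the same way; by induction on the weight this
-- gives H ≤ G, and G ≰ H because G is a Right option of H.  The first claim is one such
-- shift.  For the second, clearing both appended coins of β10ʳ1 is a Left move to β,
-- so β10ʳ1 ≰ β.  Conversely β ≤ β10ʳ1: a Left move from β to x is matched by the Left
-- move from β10ʳ1 to x10ʳ1 ≥ x (induction), and every Right move from β10ʳ1 reaches a
-- position ≥ β10ʳ1, which therefore is not ≤ β.

{-# OPTIONS --safe #-}
module Submission where

open import Defs
open import Data.Bool using (Bool; true; false; if_then_else_)
open import Data.Nat using (ℕ; zero; suc; _+_; _≤_; _<_)
open import Data.Nat.Properties
  using (≤-refl; ≤-reflexive; ≤-pred; <-trans; <-≤-trans; n<1+n; n≤1+n; n≮0; +-mono-≤-<; +-monoʳ-≤)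
open import Data.Nat.Induction using (<-wellFounded)
open import Induction.WellFounded using (Acc; acc)
open import Data.List using (List; []; _∷_; map; _++_; replicate)
open import Data.List.Relation.Unary.All using (All; []; _∷_)
open import Data.List.Relation.Unary.All.Properties using (++⁺; replicate⁺)
open import Data.List.Relation.Unary.Any using (here; there; index)
open import Data.List.Relation.Unary.Any.Properties using (lookup-index)
open import Data.List.Membership.Propositional using (_∈_)
open import Data.List.Membership.Propositional.Properties
  using (∈-map⁺; ∈-map⁻; ∈-++⁺ˡ; ∈-++⁺ʳ; ∈-++⁻; ∈-lookup)
open import Data.Product using (∃-syntax; _×_; _,_; proj₁; proj₂)
open import Data.Sum using (_⊎_; inj₁; inj₂)
open import Data.Empty using (⊥-elim)
open import Relation.Nullary using (¬_)
open import Relation.Binary.PropositionalEquality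
  using (_≡_; refl; sym; trans; cong; cong₂; subst)

LeftOption : Game → Game → Set
LeftOption G′ (mk _ _ l _) = ∃[ i ] l i ≡ G′

RightOption : Game → Game → Set
RightOption H′ (mk _ _ _ r) = ∃[ j ] r j ≡ H′

≤G-unfold : ∀ {G H} → G ≤G H →
  (∀ {G′} → LeftOption G′ G → ¬ H ≤G G′) × (∀ {H′} → RightOption H′ H → ¬ H′ ≤G G)
≤G-unfold {mk _ _ _ _} {mk _ _ _ _} (l , r) = (λ { (i , refl) → l i }) , (λ { (j , refl) → r j })

≤G-fold : ∀ {G H} →
  (∀ {G′} → LeftOption G′ G → ¬ H ≤G G′) → (∀ {H′} → RightOption H′ H → ¬ H′ ≤G G) → G ≤G H
≤G-fold {mk _ _ _ _} {mk _ _ _ _} l r = (λ i → l (i , refl)) , (λ j → r (j , refl))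

≤G-refl : ∀ G → G ≤G G
≤G-refl (mk _ _ l r) =
  (λ i h → proj₁ (≤G-unfold h) (i , refl) (≤G-refl (l i))) ,
  (λ j h → proj₂ (≤G-unfold h) (j , refl) (≤G-refl (r j)))

≤G-trans : ∀ {X Y Z} → X ≤G Y → Y ≤G Z → X ≤G Z
≤G-trans {mk _ _ _ _} {mk _ _ _ _} {mk _ _ _ _} (p₁ , p₂) (q₁ , q₂) =
  (λ i h → p₁ i (≤G-trans (q₁ , q₂) h)) ,
  (λ j h → q₂ j (≤G-trans h (p₁ , p₂)))

data Clear : List Bool → List Bool → Set where
  clear-head : ∀ xs → Clear (true ∷ xs) (false ∷ xs)
  clear-tail : ∀ b {xs ys} → Clear xs ys → Clear (b ∷ xs) (b ∷ ys)

data Shift : List Bool → List Bool → Set where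
  shift-head : ∀ {xs ys} → Clear xs ys → Shift (false ∷ xs) (true ∷ ys)
  shift-tail : ∀ b {xs ys} → Shift xs ys → Shift (b ∷ xs) (b ∷ ys)

LeftMove : List Bool → List Bool → Set
LeftMove p x = ∃[ a ] Clear p a × Clear a x

∈-clearOne⁻ : ∀ xs {x} → x ∈ clearOne xs → Clear xs x
∈-clearOne⁻ (true ∷ xs) (here refl) = clear-head xs
∈-clearOne⁻ (true ∷ xs) (there m) with ∈-map⁻ (true ∷_) m
... | _ , m′ , refl = clear-tail true (∈-clearOne⁻ xs m′)
∈-clearOne⁻ (false ∷ xs) m with ∈-map⁻ (false ∷_) m
... | _ , m′ , refl = clear-tail false (∈-clearOne⁻ xs m′)

∈-clearOne⁺ : ∀ {xs x} → Clear xs x → x ∈ clearOne xs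
∈-clearOne⁺ (clear-head xs) = here refl
∈-clearOne⁺ (clear-tail true c) = there (∈-map⁺ (true ∷_) (∈-clearOne⁺ c))
∈-clearOne⁺ (clear-tail false c) = ∈-map⁺ (false ∷_) (∈-clearOne⁺ c)

∈-leftMoves⁻ : ∀ p {x} → x ∈ leftMoves p → LeftMove p x
∈-leftMoves⁻ (true ∷ xs) m with ∈-++⁻ (map (false ∷_) (clearOne xs)) m
... | inj₁ m′ with ∈-map⁻ (false ∷_) m′
...   | _ , m″ , refl = false ∷ xs , clear-head xs , clear-tail false (∈-clearOne⁻ xs m″)
∈-leftMoves⁻ (true ∷ xs) m | inj₂ m′ with ∈-map⁻ (true ∷_) m′
...   | _ , m″ , refl with ∈-leftMoves⁻ xs m″
...     | a , c₁ , c₂ = true ∷ a , clear-tail true c₁ , clear-tail true c₂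
∈-leftMoves⁻ (false ∷ xs) m with ∈-map⁻ (false ∷_) m
... | _ , m′ , refl with ∈-leftMoves⁻ xs m′
...   | a , c₁ , c₂ = false ∷ a , clear-tail false c₁ , clear-tail false c₂

∈-leftMoves⁺ : ∀ {p x} → LeftMove p x → x ∈ leftMoves p
∈-leftMoves⁺ (_ , clear-head _ , clear-tail _ c) = ∈-++⁺ˡ (∈-map⁺ (false ∷_) (∈-clearOne⁺ c))
∈-leftMoves⁺ (_ , clear-tail true c , clear-head _) = ∈-++⁺ˡ (∈-map⁺ (false ∷_) (∈-clearOne⁺ c))
∈-leftMoves⁺ {true ∷ xs} (_ , clear-tail _ c₁ , clear-tail _ c₂) =
  ∈-++⁺ʳ (map (false ∷_) (clearOne xs)) (∈-map⁺ (true ∷_) (∈-leftMoves⁺ (_ , c₁ , c₂)))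
∈-leftMoves⁺ {false ∷ _} (_ , clear-tail _ c₁ , clear-tail _ c₂) =
  ∈-map⁺ (false ∷_) (∈-leftMoves⁺ (_ , c₁ , c₂))

∈-rightMoves⁻ : ∀ p {y} → y ∈ rightMoves p → Shift p y
∈-rightMoves⁻ (true ∷ xs) m with ∈-map⁻ (true ∷_) m
... | _ , m′ , refl = shift-tail true (∈-rightMoves⁻ xs m′)
∈-rightMoves⁻ (false ∷ xs) m with ∈-++⁻ (map (true ∷_) (clearOne xs)) m
... | inj₁ m′ with ∈-map⁻ (true ∷_) m′
...   | _ , m″ , refl = shift-head (∈-clearOne⁻ xs m″)
∈-rightMoves⁻ (false ∷ xs) m | inj₂ m′ with ∈-map⁻ (false ∷_) m′
...   | _ , m″ , refl = shift-tail false (∈-rightMoves⁻ xs m″)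

∈-rightMoves⁺ : ∀ {p y} → Shift p y → y ∈ rightMoves p
∈-rightMoves⁺ (shift-head c) = ∈-++⁺ˡ (∈-map⁺ (true ∷_) (∈-clearOne⁺ c))
∈-rightMoves⁺ (shift-tail true s) = ∈-map⁺ (true ∷_) (∈-rightMoves⁺ s)
∈-rightMoves⁺ {false ∷ xs} (shift-tail false s) =
  ∈-++⁺ʳ (map (true ∷_) (clearOne xs)) (∈-map⁺ (false ∷_) (∈-rightMoves⁺ s))

Clear-++ˡ : ∀ w {u v} → Clear u v → Clear (w ++ u) (w ++ v)
Clear-++ˡ [] c = c
Clear-++ˡ (b ∷ w) c = clear-tail b (Clear-++ˡ w c)

Shift-++ˡ : ∀ w {u v} → Shift u v → Shift (w ++ u) (w ++ v)
Shift-++ˡ [] s = s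
Shift-++ˡ (b ∷ w) s = shift-tail b (Shift-++ˡ w s)

Clear-++ʳ : ∀ zs {u v} → Clear u v → Clear (u ++ zs) (v ++ zs)
Clear-++ʳ zs (clear-head w) = clear-head (w ++ zs)
Clear-++ʳ zs (clear-tail b c) = clear-tail b (Clear-++ʳ zs c)

Shift-++ʳ : ∀ zs {u v} → Shift u v → Shift (u ++ zs) (v ++ zs)
Shift-++ʳ zs (shift-head c) = shift-head (Clear-++ʳ zs c)
Shift-++ʳ zs (shift-tail b s) = shift-tail b (Shift-++ʳ zs s)

LeftMove-++ʳ : ∀ zs {u v} → LeftMove u v → LeftMove (u ++ zs) (v ++ zs)
LeftMove-++ʳ zs (_ , c₁ , c₂) = _ , Clear-++ʳ zs c₁ , Clear-++ʳ zs c₂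

Clear-confluent : ∀ {xs x ys} → Clear xs x → Clear xs ys → x ≡ ys ⊎ ∃[ y ] Clear ys y × Clear x y
Clear-confluent (clear-head _) (clear-head _) = inj₁ refl
Clear-confluent (clear-head _) (clear-tail _ {ys = ys} c) = inj₂ (false ∷ ys , clear-head ys , clear-tail false c)
Clear-confluent (clear-tail _ {ys = x} c) (clear-head _) = inj₂ (false ∷ x , clear-tail false c , clear-head x)
Clear-confluent (clear-tail b c) (clear-tail _ c′) with Clear-confluent c c′
... | inj₁ refl = inj₁ refl
... | inj₂ (y , d , d′) = inj₂ (b ∷ y , clear-tail b d , clear-tail b d′)

Clear-swap : ∀ {xs ys y} → Clear xs ys → Clear ys y → ∃[ x ] Clear xs x × Clear x y
Clear-swap (clear-head _) (clear-tail _ {ys = y} c) = true ∷ y , clear-tail true c , clear-head y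
Clear-swap (clear-tail _ {xs = xs} c) (clear-head _) = false ∷ xs , clear-head xs , clear-tail false c
Clear-swap (clear-tail b c) (clear-tail _ c′) with Clear-swap c c′
... | x , d , d′ = b ∷ x , clear-tail b d , clear-tail b d′

Shift-Clear-confluent : ∀ {xs ys x} → Shift xs ys → Clear xs x →
  (∃[ y ] Clear ys y × Shift x y) ⊎ Clear ys x
Shift-Clear-confluent (shift-head {ys = ys} c) (clear-tail _ c′) with Clear-confluent c′ c
... | inj₁ refl = inj₂ (clear-head ys)
... | inj₂ (y , d , d′) = inj₁ (true ∷ y , clear-tail true d , shift-head d′)
Shift-Clear-confluent (shift-tail _ {ys = ys} s) (clear-head _) =
  inj₁ (false ∷ ys , clear-head ys , shift-tail false s)
Shift-Clear-confluent (shift-tail b s) (clear-tail _ c) with Shift-Clear-confluent s c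
... | inj₁ (y , d , s′) = inj₁ (b ∷ y , clear-tail b d , shift-tail b s′)
... | inj₂ d = inj₂ (clear-tail b d)

Shift-Clear-swap : ∀ {xs ys y} → Shift xs ys → Clear ys y →
  (∃[ x ] Clear xs x × Shift x y) ⊎ Clear xs y
Shift-Clear-swap (shift-head c) (clear-head _) = inj₂ (clear-tail false c)
Shift-Clear-swap (shift-head c) (clear-tail _ c′) with Clear-swap c c′
... | x , d , d′ = inj₁ (false ∷ x , clear-tail false d , shift-head d′)
Shift-Clear-swap (shift-tail _ {xs = xs} s) (clear-head _) =
  inj₁ (false ∷ xs , clear-head xs , shift-tail false s)
Shift-Clear-swap (shift-tail b s) (clear-tail _ c) with Shift-Clear-swap s c
... | inj₁ (x , d , s′) = inj₁ (b ∷ x , clear-tail b d , shift-tail b s′)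
... | inj₂ d = inj₂ (clear-tail b d)

Clear-Shift-swap : ∀ {xs ys y} → Clear xs ys → Shift ys y →
  Clear xs y ⊎ ∃[ x ] Shift xs x × Clear x y
Clear-Shift-swap (clear-head _) (shift-head c) = inj₁ (clear-tail true c)
Clear-Shift-swap (clear-head _) (shift-tail _ {ys = y} s) = inj₂ (true ∷ y , shift-tail true s , clear-head y)
Clear-Shift-swap (clear-tail _ c) (shift-head c′) with Clear-swap c c′
... | x , d , d′ = inj₂ (true ∷ x , shift-head d , clear-tail true d′)
Clear-Shift-swap (clear-tail b c) (shift-tail _ s) with Clear-Shift-swap c s
... | inj₁ d = inj₁ (clear-tail b d)
... | inj₂ (x , s′ , d) = inj₂ (b ∷ x , shift-tail b s′ , clear-tail b d)

Shift-respondsLeft : ∀ {H G x} → Shift H G → LeftMove H x →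
  (∃[ y ] LeftMove G y × Shift x y) ⊎ LeftMove G x
Shift-respondsLeft s (_ , c₁ , c₂) with Shift-Clear-confluent s c₁
... | inj₂ d = inj₂ (_ , d , c₂)
... | inj₁ (b , d , s′) with Shift-Clear-confluent s′ c₂
...   | inj₁ (y , d′ , s″) = inj₁ (y , (b , d , d′) , s″)
...   | inj₂ d′ = inj₂ (b , d , d′)

Shift-respondsRight : ∀ {H G y} → Shift H G → Shift G y → (∃[ x ] Shift H x × Shift x y) ⊎ Shift H y
Shift-respondsRight (shift-head c) (shift-tail _ s) with Clear-Shift-swap c s
... | inj₁ d = inj₂ (shift-head d)
... | inj₂ (x , s′ , d) = inj₁ (false ∷ x , shift-tail false s′ , shift-head d)
Shift-respondsRight (shift-tail _ s) (shift-head c) with Shift-Clear-swap s c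
... | inj₁ (x , d , s′) = inj₁ (true ∷ x , shift-head d , shift-tail true s′)
... | inj₂ d = inj₂ (shift-head d)
Shift-respondsRight (shift-tail b s) (shift-tail _ s′) with Shift-respondsRight s s′
... | inj₁ (x , t , t′) = inj₁ (b ∷ x , shift-tail b t , shift-tail b t′)
... | inj₂ t = inj₂ (shift-tail b t)

ones-Clear : ∀ {xs ys} → Clear xs ys → ones xs ≡ suc (ones ys)
ones-Clear (clear-head _) = refl
ones-Clear (clear-tail true c) = cong suc (ones-Clear c)
ones-Clear (clear-tail false c) = ones-Clear c

ones-Shift : ∀ {xs ys} → Shift xs ys → ones xs ≡ ones ys
ones-Shift (shift-head c) = ones-Clear c
ones-Shift (shift-tail true s) = cong suc (ones-Shift s)
ones-Shift (shift-tail false s) = ones-Shift s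

weight-Clear< : ∀ {xs ys} → Clear xs ys → weight ys < weight xs
weight-Clear< (clear-head _) = n<1+n _
weight-Clear< {_ ∷ xs} {_ ∷ ys} (clear-tail b c) =
  +-mono-≤-< (+-monoʳ-≤ (if b then 1 else 0) ones≤) (weight-Clear< c)
  where
  ones≤ : ones ys ≤ ones xs
  ones≤ = subst (ones ys ≤_) (sym (ones-Clear c)) (n≤1+n _)

weight-Shift< : ∀ {xs ys} → Shift xs ys → weight ys < weight xs
weight-Shift< (shift-head c) = +-mono-≤-< (≤-reflexive (sym (ones-Clear c))) (weight-Clear< c)
weight-Shift< (shift-tail b s) =
  +-mono-≤-< (≤-reflexive (cong ((if b then 1 else 0) +_) (sym (ones-Shift s)))) (weight-Shift< s)

weight-LeftMove< : ∀ {p x} → LeftMove p x → weight x < weight p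
weight-LeftMove< (_ , c₁ , c₂) = <-trans (weight-Clear< c₂) (weight-Clear< c₁)

Zeros : List Bool → Set
Zeros = All (_≡ false)

strip-zeros : ∀ {zs} → Zeros zs → strip zs ≡ []
strip-zeros [] = refl
strip-zeros (refl ∷ z) rewrite strip-zeros z = refl

strip-++-zeros : ∀ u {zs} → Zeros zs → strip (u ++ zs) ≡ strip u
strip-++-zeros [] z = strip-zeros z
strip-++-zeros (b ∷ u) z rewrite strip-++-zeros u z with strip u
... | [] = refl
... | _ ∷ _ = refl

strip-split : ∀ p → ∃[ zs ] Zeros zs × p ≡ strip p ++ zs
strip-split [] = [] , [] , refl
strip-split (b ∷ xs) with strip xs | strip-split xs
strip-split (true ∷ xs) | [] | zs , z , e = zs , z , cong (true ∷_) e
strip-split (false ∷ xs) | [] | zs , z , e = false ∷ zs , refl ∷ z , cong (false ∷_) e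
strip-split (b ∷ xs) | _ ∷ _ | zs , z , e = zs , z , cong (b ∷_) e

ones-++-zeros : ∀ u {zs} → Zeros zs → ones (u ++ zs) ≡ ones u
ones-++-zeros [] [] = refl
ones-++-zeros [] (refl ∷ z) = ones-++-zeros [] z
ones-++-zeros (b ∷ u) z = cong ((if b then 1 else 0) +_) (ones-++-zeros u z)

weight-++-zeros : ∀ u {zs} → Zeros zs → weight (u ++ zs) ≡ weight u
weight-++-zeros [] [] = refl
weight-++-zeros [] (refl ∷ z) = cong₂ _+_ (ones-++-zeros [] z) (weight-++-zeros [] z)
weight-++-zeros (b ∷ u) z = cong₂ _+_ (ones-++-zeros (b ∷ u) z) (weight-++-zeros u z)

weight-strip : ∀ p → weight (strip p) ≡ weight p
weight-strip p with strip-split p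
... | zs , z , e = trans (sym (weight-++-zeros (strip p) z)) (cong weight (sym e))

coins-++-zeros : ∀ u {zs} → Zeros zs → coins (u ++ zs) ≡ coins u
coins-++-zeros u z = cong (λ s → build (weight s) s) (strip-++-zeros u z)

Clear-zeros-⊥ : ∀ {zs v} → Zeros zs → ¬ Clear zs v
Clear-zeros-⊥ (refl ∷ z) (clear-tail _ c) = Clear-zeros-⊥ z c

Shift-zeros-⊥ : ∀ {zs v} → Zeros zs → ¬ Shift zs v
Shift-zeros-⊥ (refl ∷ z) (shift-head c) = Clear-zeros-⊥ z c
Shift-zeros-⊥ (refl ∷ z) (shift-tail _ s) = Shift-zeros-⊥ z s

Clear-++-zeros⁻ : ∀ u {zs v} → Zeros zs → Clear (u ++ zs) v → ∃[ v′ ] v ≡ v′ ++ zs × Clear u v′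
Clear-++-zeros⁻ [] z c = ⊥-elim (Clear-zeros-⊥ z c)
Clear-++-zeros⁻ (true ∷ u) z (clear-head _) = false ∷ u , refl , clear-head u
Clear-++-zeros⁻ (b ∷ u) z (clear-tail _ c) with Clear-++-zeros⁻ u z c
... | v′ , refl , c′ = b ∷ v′ , refl , clear-tail b c′

Shift-++-zeros⁻ : ∀ u {zs v} → Zeros zs → Shift (u ++ zs) v → ∃[ v′ ] v ≡ v′ ++ zs × Shift u v′
Shift-++-zeros⁻ [] z s = ⊥-elim (Shift-zeros-⊥ z s)
Shift-++-zeros⁻ (false ∷ u) z (shift-head c) with Clear-++-zeros⁻ u z c
... | v′ , refl , c′ = true ∷ v′ , refl , shift-head c′
Shift-++-zeros⁻ (b ∷ u) z (shift-tail _ s) with Shift-++-zeros⁻ u z s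
... | v′ , refl , s′ = b ∷ v′ , refl , shift-tail b s′

LeftMove-strip⁺ : ∀ {p x} → LeftMove p x → ∃[ x′ ] LeftMove (strip p) x′ × strip x ≡ strip x′
LeftMove-strip⁺ {p} (a , c₁ , c₂) with strip-split p
... | zs , z , e with Clear-++-zeros⁻ (strip p) z (subst (λ q → Clear q a) e c₁)
...   | a′ , refl , c₁′ with Clear-++-zeros⁻ a′ z c₂
...     | x′ , refl , c₂′ = x′ , (a′ , c₁′ , c₂′) , strip-++-zeros x′ z

LeftMove-strip⁻ : ∀ {p x′} → LeftMove (strip p) x′ → ∃[ x ] LeftMove p x × strip x ≡ strip x′
LeftMove-strip⁻ {p} {x′} m with strip-split p
... | zs , z , e = x′ ++ zs , subst (λ q → LeftMove q (x′ ++ zs)) (sym e) (LeftMove-++ʳ zs m) , strip-++-zeros x′ z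

Shift-strip⁺ : ∀ {p y} → Shift p y → ∃[ y′ ] Shift (strip p) y′ × strip y ≡ strip y′
Shift-strip⁺ {p} s with strip-split p
... | zs , z , e with Shift-++-zeros⁻ (strip p) z (subst (λ q → Shift q _) e s)
...   | y′ , refl , s′ = y′ , s′ , strip-++-zeros y′ z

Shift-strip⁻ : ∀ {p y′} → Shift (strip p) y′ → ∃[ y ] Shift p y × strip y ≡ strip y′
Shift-strip⁻ {p} {y′} s with strip-split p
... | zs , z , e = y′ ++ zs , subst (λ q → Shift q (y′ ++ zs)) (sym e) (Shift-++ʳ zs s) , strip-++-zeros y′ z

weight-strip-LeftMove< : ∀ {p x} → LeftMove p x → weight (strip x) < weight p
weight-strip-LeftMove< {x = x} m = subst (_< _) (sym (weight-strip x)) (weight-LeftMove< m)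

weight-strip-Shift< : ∀ {p y} → Shift p y → weight (strip y) < weight p
weight-strip-Shift< {y = y} s = subst (_< _) (sym (weight-strip y)) (weight-Shift< s)

weight-leftOption< : ∀ s {x} → x ∈ map strip (leftMoves s) → weight x < weight s
weight-leftOption< s m with ∈-map⁻ strip m
... | _ , m′ , refl = weight-strip-LeftMove< (∈-leftMoves⁻ s m′)

weight-rightOption< : ∀ s {y} → y ∈ map strip (rightMoves s) → weight y < weight s
weight-rightOption< s m with ∈-map⁻ strip m
... | _ , m′ , refl = weight-strip-Shift< (∈-rightMoves⁻ s m′)

build-fuel : ∀ f g s → weight s ≤ f → weight s ≤ g → build f s ≤G build g s
build-fuel zero zero s _ _ = (λ ()) , (λ ())
build-fuel zero (suc g) s w _ = (λ ()) , (λ j _ → n≮0 (<-≤-trans (weight-rightOption< s (∈-lookup j)) w))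
build-fuel (suc f) zero s _ w = (λ i _ → n≮0 (<-≤-trans (weight-leftOption< s (∈-lookup i)) w)) , (λ ())
build-fuel (suc f) (suc g) s w w′ =
  (λ i h → proj₁ (≤G-unfold h) (i , refl)
    (build-fuel f g _ (≤-pred (<-≤-trans (weight-leftOption< s (∈-lookup i)) w))
                      (≤-pred (<-≤-trans (weight-leftOption< s (∈-lookup i)) w′)))) ,
  (λ j h → proj₂ (≤G-unfold h) (j , refl)
    (build-fuel f g _ (≤-pred (<-≤-trans (weight-rightOption< s (∈-lookup j)) w))
                      (≤-pred (<-≤-trans (weight-rightOption< s (∈-lookup j)) w′))))

leftOption-build⁺ : ∀ {f s x} → weight s ≤ f → x ∈ leftMoves s →
  ∃[ G′ ] LeftOption G′ (build f s) × coins x ≤G G′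
leftOption-build⁺ {zero} {s} w m = ⊥-elim (n≮0 (<-≤-trans (weight-LeftMove< (∈-leftMoves⁻ s m)) w))
leftOption-build⁺ {suc f} {s} {x} w m =
  build f (strip x) , (index m′ , cong (build f) (sym (lookup-index m′))) ,
  build-fuel _ f (strip x) ≤-refl (≤-pred (<-≤-trans (weight-leftOption< s m′) w))
  where
  m′ = ∈-map⁺ strip m

leftOption-build⁻ : ∀ {f s G′} → weight s ≤ f → LeftOption G′ (build f s) →
  ∃[ x ] x ∈ leftMoves s × G′ ≤G coins x
leftOption-build⁻ {suc f} {s} w (i , refl) with ∈-map⁻ strip (∈-lookup {xs = map strip (leftMoves s)} i)
... | x , m , e rewrite e =
  x , m , build-fuel f _ (strip x) (≤-pred (<-≤-trans (weight-strip-LeftMove< (∈-leftMoves⁻ s m)) w)) ≤-refl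

rightOption-build⁺ : ∀ {f s y} → weight s ≤ f → y ∈ rightMoves s →
  ∃[ H′ ] RightOption H′ (build f s) × H′ ≤G coins y
rightOption-build⁺ {zero} {s} w m = ⊥-elim (n≮0 (<-≤-trans (weight-Shift< (∈-rightMoves⁻ s m)) w))
rightOption-build⁺ {suc f} {s} {y} w m =
  build f (strip y) , (index m′ , cong (build f) (sym (lookup-index m′))) ,
  build-fuel f _ (strip y) (≤-pred (<-≤-trans (weight-rightOption< s m′) w)) ≤-refl
  where
  m′ = ∈-map⁺ strip m

rightOption-build⁻ : ∀ {f s H′} → weight s ≤ f → RightOption H′ (build f s) →
  ∃[ y ] y ∈ rightMoves s × coins y ≤G H′
rightOption-build⁻ {suc f} {s} w (j , refl) with ∈-map⁻ strip (∈-lookup {xs = map strip (rightMoves s)} j)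
... | y , m , e rewrite e =
  y , m , build-fuel _ f (strip y) ≤-refl (≤-pred (<-≤-trans (weight-strip-Shift< (∈-rightMoves⁻ s m)) w))

leftOption-coins⁺ : ∀ {p x} → LeftMove p x → ∃[ G′ ] LeftOption G′ (coins p) × coins x ≤G G′
leftOption-coins⁺ m with LeftMove-strip⁺ m
... | _ , m′ , e rewrite e = leftOption-build⁺ ≤-refl (∈-leftMoves⁺ m′)

leftOption-coins⁻ : ∀ {p G′} → LeftOption G′ (coins p) → ∃[ x ] LeftMove p x × G′ ≤G coins x
leftOption-coins⁻ {p} {G′} o with leftOption-build⁻ ≤-refl o
... | _ , m , h with LeftMove-strip⁻ (∈-leftMoves⁻ (strip p) m)
...   | x , m′ , e = x , m′ , subst (λ q → G′ ≤G build (weight q) q) (sym e) h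

rightOption-coins⁺ : ∀ {q y} → Shift q y → ∃[ H′ ] RightOption H′ (coins q) × H′ ≤G coins y
rightOption-coins⁺ s with Shift-strip⁺ s
... | _ , s′ , e rewrite e = rightOption-build⁺ ≤-refl (∈-rightMoves⁺ s′)

rightOption-coins⁻ : ∀ {q H′} → RightOption H′ (coins q) → ∃[ y ] Shift q y × coins y ≤G H′
rightOption-coins⁻ {q} {H′} o with rightOption-build⁻ ≤-refl o
... | _ , m , h with Shift-strip⁻ (∈-rightMoves⁻ (strip q) m)
...   | y , s , e = y , s , subst (λ r → build (weight r) r ≤G H′) (sym e) h

coins-≤-left : ∀ {p q x} → coins p ≤G coins q → LeftMove p x → ¬ coins q ≤G coins x
coins-≤-left h m h′ with leftOption-coins⁺ m
... | _ , o , le = proj₁ (≤G-unfold h) o (≤G-trans h′ le)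

coins-≤-right : ∀ {p q y} → coins p ≤G coins q → Shift q y → ¬ coins y ≤G coins p
coins-≤-right h s h′ with rightOption-coins⁺ s
... | _ , o , le = proj₂ (≤G-unfold h) o (≤G-trans le h′)

coins-≤-intro : ∀ {p q} →
  (∀ {x} → LeftMove p x → ¬ coins q ≤G coins x) → (∀ {y} → Shift q y → ¬ coins y ≤G coins p) →
  coins p ≤G coins q
coins-≤-intro l r = ≤G-fold
  (λ o h → let _ , m , le = leftOption-coins⁻ o in l m (≤G-trans h le))
  (λ o h → let _ , s , le = rightOption-coins⁻ o in r s (≤G-trans le h))

Shift⇒≤ : ∀ {H G} → Acc _<_ (weight H) → Shift H G → coins H ≤G coins G
Shift⇒≤ {H} {G} (acc rec) s = coins-≤-intro {H} {G} respondLeft respondRight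
  where
  respondLeft : ∀ {x} → LeftMove H x → ¬ coins G ≤G coins x
  respondLeft {x} m h with Shift-respondsLeft s m
  ... | inj₁ (_ , m′ , s′) = coins-≤-left {q = x} h m′ (Shift⇒≤ (rec (weight-LeftMove< m)) s′)
  ... | inj₂ m′ = coins-≤-left {q = x} h m′ (≤G-refl (coins x))

  respondRight : ∀ {y} → Shift G y → ¬ coins y ≤G coins H
  respondRight {y} t h with Shift-respondsRight s t
  ... | inj₁ (_ , s₁ , s₂) = coins-≤-right {p = y} h s₁ (Shift⇒≤ (rec (weight-Shift< s₁)) s₂)
  ... | inj₂ s′ = coins-≤-right {p = y} h s′ (≤G-refl (coins y))

Shift⇒< : ∀ {H G} → Shift H G → coins G >G coins H
Shift⇒< {G = G} s =
  Shift⇒≤ (<-wellFounded _) s , λ h → coins-≤-right {p = G} h s (≤G-refl (coins G))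

clear-at : ∀ α β → Clear (α ++ true ∷ β) (α ++ false ∷ β)
clear-at α β = Clear-++ˡ α (clear-head β)

shift-at : ∀ α β γ → Shift (α ++ false ∷ β ++ true ∷ γ) (α ++ true ∷ β ++ false ∷ γ)
shift-at α β γ = Shift-++ˡ α (shift-head (clear-at β γ))

coinPair : ℕ → List Bool
coinPair r = true ∷ replicate r false ++ true ∷ []

coinPair-≰ : ∀ β r → ¬ coins (β ++ coinPair r) ≤G coins β
coinPair-≰ β r h = coins-≤-left {q = β} h bothCleared (subst (coins β ≤G_) sameCoins (≤G-refl (coins β)))
  where
  bothCleared : LeftMove (β ++ coinPair r) (β ++ false ∷ replicate r false ++ false ∷ [])
  bothCleared = _ , clear-at β _ , Clear-++ˡ β (clear-tail false (clear-at (replicate r false) []))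

  sameCoins : coins β ≡ coins (β ++ false ∷ replicate r false ++ false ∷ [])
  sameCoins = sym (coins-++-zeros β (refl ∷ ++⁺ (replicate⁺ r refl) (refl ∷ [])))

coinPair-≥ : ∀ β → Acc _<_ (weight β) → ∀ r → coins β ≤G coins (β ++ coinPair r)
coinPair-≥ β (acc rec) r = coins-≤-intro {β} {β ++ coinPair r} respondLeft respondRight
  where
  respondLeft : ∀ {x} → LeftMove β x → ¬ coins (β ++ coinPair r) ≤G coins x
  respondLeft {x} m h =
    coins-≤-left {q = x} h (LeftMove-++ʳ (coinPair r) m) (coinPair-≥ x (rec (weight-LeftMove< m)) r)

  respondRight : ∀ {y} → Shift (β ++ coinPair r) y → ¬ coins y ≤G coins β
  respondRight s h = coinPair-≰ β r (≤G-trans (Shift⇒≤ (<-wellFounded _) s) h)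

corollary4p1 :
    ((α β γ : List Bool) →
      coins (α ++ true ∷ β ++ false ∷ γ) >G coins (α ++ false ∷ β ++ true ∷ γ))
    ×
    ((β : List Bool) (r : ℕ) →
      coins (β ++ true ∷ replicate r false ++ true ∷ []) >G coins β)
corollary4p1 =
  (λ α β γ → Shift⇒< (shift-at α β γ)) ,
  (λ β r → coinPair-≥ β (<-wellFounded _) r , coinPair-≰ β r)
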